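{- Let $x$ be a vertex of a connected graph $G$. Then there exists an $x$-visibility set $S$ with $|S|=v_x(G)$ such that: (1) every $y\in V(G)\setminus\{x\}$ is $S$-visible from $x$; (2) $\mathrm{MD}_G(x)\subseteq S$; (3) $S$ contains no stress vertex for $x$. Moreover, $|\mathrm{MD}_G(x)|\le v_x(G)\le n(G)-\mathrm{str}_G(x)-1$.
   Context: All graphs are finite and simple. For $x\in V(G)$, a set $S\subseteq V(G)\setminus\{x\}$ is an $x$-visibility set if for every $y\in S$ there exists a shortest $x,y$-path $P$ with $V(P)\cap S=\{y\}$; $v_x(G)$ is the maximum size of an $x$-visibility set. For $S\subseteq V(G)$, a vertex $y$ is $S$-visible from $x$ if there is a shortest $x,y$-path $P$ with $V(P)\cap S\subseteq\{x,y\}$. A vertex $y$ is maximally distant from $x$ if $d_G(x,y)\ge d_G(x,z)$ for every neighbor $z$ of $y$; $\mathrm{MD}_G(x)$ is the set of vertices maximally distant from $x$. A vertex $y$ is a stress vertex for $x$ if there exists a vertex $z$ maximally distant from $x$ such that $y$ lies on every shortest $x,z$-path (every cut vertex $y\ne x$ is a stress vertex for $x$); $\mathrm{str}_G(x)$ denotes the number of stress vertices for $x$. -}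

module Defs where

open import Data.Nat using (ℕ; zero; suc; _≤_)
open import Data.Fin using (Fin)
open import Data.Fin.Subset using (Subset; _∈_; _∉_)
open import Data.Product using (Σ; ∃; _×_; _,_)
open import Data.Sum using (_⊎_)
open import Relation.Nullary using (¬_; Dec)
open import Relation.Binary.PropositionalEquality using (_≡_; _≢_)
open import Level using (0ℓ)

record Graph : Set₁ where
  field
    n       : ℕ
    Adj     : Fin n → Fin n → Set
    adj?    : ∀ u v → Dec (Adj u v)
    sym     : ∀ {u v} → Adj u v → Adj v u
    irrefl  : ∀ {u} → ¬ Adj u u

module _ (G : Graph) where
  open Graph G

  V : Set
  V = Fin n

  data Walk : V → V → ℕ → Set where
    [_]  : (x : V) → Walk x x 0
    _∷_  : ∀ {x y z k} → Adj x y → Walk y z k → Walk x z (suc k)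

  data OnWalk (v : V) : ∀ {x y k} → Walk x y k → Set where
    here-end : OnWalk v [ v ]
    here     : ∀ {y z k} (e : Adj v y) (w : Walk y z k) → OnWalk v (e ∷ w)
    there    : ∀ {x y z k} (e : Adj x y) {w : Walk y z k} → OnWalk v w → OnWalk v (e ∷ w)

  Connected : Set
  Connected = ∀ x y → ∃ λ k → Walk x y k

  Shortest : ∀ {x y k} → Walk x y k → Set
  Shortest {x} {y} {k} _ = ∀ k' → Walk x y k' → k ≤ k'

  Dist : V → V → ℕ → Set
  Dist x y d = Σ (Walk x y d) Shortest

  VisibilitySet : V → Subset n → Set
  VisibilitySet x S =
    x ∉ S ×
    (∀ y → y ∈ S → ∃ λ k → Σ (Walk x y k) λ P →
        Shortest P × (∀ z → OnWalk z P → z ∈ S → z ≡ y))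

  IsVisibilityNumber : V → ℕ → Set
  IsVisibilityNumber x m =
    (∃ λ S → VisibilitySet x S × Data.Fin.Subset.∣ S ∣ ≡ m) ×
    (∀ S → VisibilitySet x S → Data.Fin.Subset.∣ S ∣ ≤ m)

  SVisible : V → Subset n → V → Set
  SVisible x S y = ∃ λ k → Σ (Walk x y k) λ P →
    Shortest P × (∀ z → OnWalk z P → z ∈ S → z ≡ x ⊎ z ≡ y)

  MaxDist : V → V → Set
  MaxDist x y = ∀ z → Adj y z → ∀ dy dz → Dist x y dy → Dist x z dz → dz ≤ dy

  Stress : V → V → Set
  Stress x y = y ≢ x × ∃ λ z → MaxDist x z × y ≢ z ×
    (∀ k (P : Walk x z k) → Shortest P → OnWalk y P)

-- Start from a maximum x-visibility set S. If some vertex is not S-visible, follow a shortest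
-- path back from it to the first hidden vertex w; its predecessor u lies in S and is one step
-- closer to x. Replacing u by w gives a visibility set of the same size whose visible vertices
-- strictly include those of S, so iterating makes every vertex visible. Then a maximally distant
-- vertex outside S could be added to S (it lies inside no shortest path to a farther vertex),
-- contradicting maximality; and a stress vertex on every shortest path to some maximally
-- distant z ∈ S would hide z. The bounds follow since MD ⊆ S and S, the stress vertices and
-- {x} are pairwise disjoint.
module Submission where

open import Defs
open import Data.Empty using (⊥-elim)
open import Data.Fin.Base using (Fin) renaming (zero to fzero; suc to fsuc)
open import Data.Fin.Properties using (_≟_; any?; all?; ¬∀⟶∃¬)
open import Data.Fin.Subset using (Subset; _∈_; _∉_; ∣_∣; inside; outside)
open import Data.Fin.Subset.Properties using (_∈?_; p⊆q⇒∣p∣≤∣q∣; p⊂q⇒∣p∣<∣q∣; ∣p∣≤n)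
open import Data.Nat.Base using (ℕ; zero; suc; _+_; _≤_; _<_; z≤n; s≤s; s≤s⁻¹)
open import Data.Nat.Induction using (<-wellFounded)
open import Data.Nat.Properties
  using (module ≤-Reasoning; ≤-trans; ≤-antisym; ≤-<-trans; <-≤-trans; <-irrefl; ≮⇒≥; anyUpTo?;
         +-suc; +-comm; +-assoc; +-cancelʳ-≤; +-monoʳ-<; m≤m+n; m<m+n; m≤n⇒m≤1+n)
open import Data.Product using (Σ; ∃; ∃₂; _×_; _,_; proj₁; proj₂)
open import Data.Sum using (_⊎_; inj₁; inj₂; map₁)
open import Data.Unit using (tt)
open import Data.Vec.Base using ([]; _∷_; tabulate; _[_]≔_) renaming (here to vhere; there to vthere)
open import Data.Vec.Properties using (lookup∘update; lookup∘update′; []=⇒lookup; lookup⇒[]=; lookup∘tabulate)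
open import Function using (id; _∘_; case_of_)
open import Function.Bundles using (_⇔_; Equivalence)
open import Induction.WellFounded using (Acc; acc)
open import Level using (0ℓ)
open import Relation.Nullary using (¬_; Dec; yes; no; does)
open import Relation.Nullary.Decidable using (dec-true; dec-false; decidable-stable; map′; _×-dec_; _⊎-dec_; _→-dec_)
open import Relation.Unary using (Pred; Decidable)
open import Relation.Binary.PropositionalEquality using (_≡_; _≢_; refl; sym; trans; cong; subst)

module _ {N : ℕ} where

  i∈p[i]≔inside : ∀ (p : Subset N) i → i ∈ p [ i ]≔ inside
  i∈p[i]≔inside p i = lookup⇒[]= i _ (lookup∘update i p inside)

  i∉p[i]≔outside : ∀ (p : Subset N) i → i ∉ p [ i ]≔ outside
  i∉p[i]≔outside p i i∈ with trans (sym ([]=⇒lookup i∈)) (lookup∘update i p outside)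
  ... | ()

  j∈p[i]≔b⇒j∈p : ∀ (p : Subset N) {i j} b → j ≢ i → j ∈ p [ i ]≔ b → j ∈ p
  j∈p[i]≔b⇒j∈p p b j≢i j∈ = lookup⇒[]= _ p (trans (sym (lookup∘update′ j≢i p b)) ([]=⇒lookup j∈))

  j∈p[i]≔outside⇒j∈p : ∀ (p : Subset N) {i j} → j ∈ p [ i ]≔ outside → j ∈ p
  j∈p[i]≔outside⇒j∈p p {i} {j} j∈ with j ≟ i
  ... | yes refl = ⊥-elim (i∉p[i]≔outside p i j∈)
  ... | no  j≢i  = j∈p[i]≔b⇒j∈p p outside j≢i j∈

i∉p⇒∣p[i]≔inside∣≡1+∣p∣ : ∀ {N} (p : Subset N) i → i ∉ p → ∣ p [ i ]≔ inside ∣ ≡ suc ∣ p ∣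
i∉p⇒∣p[i]≔inside∣≡1+∣p∣ (outside ∷ p) fzero    i∉p = refl
i∉p⇒∣p[i]≔inside∣≡1+∣p∣ (inside  ∷ p) fzero    i∉p = ⊥-elim (i∉p vhere)
i∉p⇒∣p[i]≔inside∣≡1+∣p∣ (inside  ∷ p) (fsuc i) i∉p = cong suc (i∉p⇒∣p[i]≔inside∣≡1+∣p∣ p i (i∉p ∘ vthere))
i∉p⇒∣p[i]≔inside∣≡1+∣p∣ (outside ∷ p) (fsuc i) i∉p = i∉p⇒∣p[i]≔inside∣≡1+∣p∣ p i (i∉p ∘ vthere)

i∈p⇒∣p∣≡1+∣p[i]≔outside∣ : ∀ {N} (p : Subset N) i → i ∈ p → ∣ p ∣ ≡ suc ∣ p [ i ]≔ outside ∣
i∈p⇒∣p∣≡1+∣p[i]≔outside∣ (inside  ∷ p) fzero    i∈p           = refl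
i∈p⇒∣p∣≡1+∣p[i]≔outside∣ (inside  ∷ p) (fsuc i) (vthere i∈p) = cong suc (i∈p⇒∣p∣≡1+∣p[i]≔outside∣ p i i∈p)
i∈p⇒∣p∣≡1+∣p[i]≔outside∣ (outside ∷ p) (fsuc i) (vthere i∈p) = i∈p⇒∣p∣≡1+∣p[i]≔outside∣ p i i∈p

∷-disjoint⁻ : ∀ {N b c} {p q : Subset N} → (∀ v → v ∈ b ∷ p → v ∉ c ∷ q) → ∀ v → v ∈ p → v ∉ q
∷-disjoint⁻ disjoint v v∈p v∈q = disjoint (fsuc v) (vthere v∈p) (vthere v∈q)

disjoint⇒∣p∣+∣q∣≤n : ∀ {N} (p q : Subset N) → (∀ v → v ∈ p → v ∉ q) → ∣ p ∣ + ∣ q ∣ ≤ N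
disjoint⇒∣p∣+∣q∣≤n []            []            _        = z≤n
disjoint⇒∣p∣+∣q∣≤n (inside  ∷ p) (inside  ∷ q) disjoint = ⊥-elim (disjoint fzero vhere vhere)
disjoint⇒∣p∣+∣q∣≤n (inside  ∷ p) (outside ∷ q) disjoint = s≤s (disjoint⇒∣p∣+∣q∣≤n p q (∷-disjoint⁻ disjoint))
disjoint⇒∣p∣+∣q∣≤n {suc N} (outside ∷ p) (inside  ∷ q) disjoint =
  subst (_≤ suc N) (sym (+-suc ∣ p ∣ ∣ q ∣)) (s≤s (disjoint⇒∣p∣+∣q∣≤n p q (∷-disjoint⁻ disjoint)))
disjoint⇒∣p∣+∣q∣≤n (outside ∷ p) (outside ∷ q) disjoint =
  m≤n⇒m≤1+n (disjoint⇒∣p∣+∣q∣≤n p q (∷-disjoint⁻ disjoint))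

disjoint-avoiding⇒∣p∣+∣q∣+1≤n : ∀ {N} (p q : Subset N) {i} → (∀ v → v ∈ p → v ∉ q) → i ∉ p → i ∉ q →
                                ∣ p ∣ + ∣ q ∣ + 1 ≤ N
disjoint-avoiding⇒∣p∣+∣q∣+1≤n {N} p q {i} disjoint i∉p i∉q = begin
  ∣ p ∣ + ∣ q ∣ + 1               ≡⟨ trans (+-assoc ∣ p ∣ ∣ q ∣ 1) (cong (∣ p ∣ +_) (+-comm ∣ q ∣ 1)) ⟩
  ∣ p ∣ + suc ∣ q ∣               ≡⟨ cong (∣ p ∣ +_) (sym (i∉p⇒∣p[i]≔inside∣≡1+∣p∣ q i i∉q)) ⟩
  ∣ p ∣ + ∣ q [ i ]≔ inside ∣     ≤⟨ disjoint⇒∣p∣+∣q∣≤n p (q [ i ]≔ inside) disjoint′ ⟩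
  N                               ∎
  where
    open ≤-Reasoning
    disjoint′ : ∀ v → v ∈ p → v ∉ q [ i ]≔ inside
    disjoint′ v v∈p v∈q′ with v ≟ i
    ... | yes refl = i∉p v∈p
    ... | no  v≢i  = disjoint v v∈p (j∈p[i]≔b⇒j∈p q inside v≢i v∈q′)

∃-other : ∀ {N} → 2 ≤ N → (i : Fin N) → ∃ λ j → j ≢ i
∃-other (s≤s (s≤s _)) fzero    = fsuc fzero , λ ()
∃-other (s≤s (s≤s _)) (fsuc _) = fzero , λ ()

minimal : {P : Pred ℕ 0ℓ} → Decidable P → ∀ {k} → P k → ∃ λ d → P d × (∀ {j} → P j → d ≤ j)
minimal {P} P? {k} = go k (<-wellFounded k)
  where
    go : ∀ k → Acc _<_ k → P k → ∃ λ d → P d × (∀ {j} → P j → d ≤ j)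
    go k (acc rec) pk with anyUpTo? P? k
    ... | yes (j , j<k , pj) = go j (rec j<k) pj
    ... | no  none           = k , pk , λ {j} pj → ≮⇒≥ (λ j<k → none (j , j<k , pj))

module Walks (G : Graph) where
  open Graph G using (Adj; adj?)

  private variable
    a b c z : V G
    k l m : ℕ

  snoc : Walk G a b k → Adj b c → Walk G a c (suc k)
  snoc [ _ ]    e = e ∷ [ _ ]
  snoc (e′ ∷ P) e = e′ ∷ snoc P e

  _++ᵂ_ : Walk G a b l → Walk G b c m → Walk G a c (l + m)
  [ _ ]   ++ᵂ Q = Q
  (e ∷ P) ++ᵂ Q = e ∷ (P ++ᵂ Q)

  walk₀⇒≡ : Walk G a b 0 → a ≡ b
  walk₀⇒≡ [ _ ] = refl

  unsnoc : Walk G a c (suc k) → ∃ λ b → Walk G a b k × Adj b c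
  unsnoc {k = zero}  (e ∷ [ _ ]) = _ , [ _ ] , e
  unsnoc {k = suc k} (e ∷ P) with unsnoc P
  ... | b , Q , e′ = b , e ∷ Q , e′

  onWalk-snoc⁻ : (P : Walk G a b k) (e : Adj b c) → OnWalk G z (snoc P e) → OnWalk G z P ⊎ z ≡ c
  onWalk-snoc⁻ [ _ ]    e (here _ _)          = inj₁ here-end
  onWalk-snoc⁻ [ _ ]    e (there _ here-end)  = inj₂ refl
  onWalk-snoc⁻ (e′ ∷ P) e (here _ _)          = inj₁ (here e′ P)
  onWalk-snoc⁻ (e′ ∷ P) e (there _ z∈)        = map₁ (there e′) (onWalk-snoc⁻ P e z∈)

  shortest-init : (Q : Walk G a b k) (e : Adj b c) → Shortest G (snoc Q e) → Shortest G Q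
  shortest-init Q e sh k′ W = s≤s⁻¹ (sh _ (snoc W e))

  dist-unique : Dist G a b l → Dist G a b m → l ≡ m
  dist-unique (P , sh) (P′ , sh′) = ≤-antisym (sh _ P′) (sh′ _ P)

  record Split (P : Walk G a b k) (z : V G) : Set where
    field
      {i j}     : ℕ
      prefix    : Walk G a z i
      suffix    : Walk G z b j
      length-eq : i + j ≡ k
      prefix⊆   : ∀ {t} → OnWalk G t prefix → OnWalk G t P

  split : (P : Walk G a b k) → OnWalk G z P → Split P z
  split [ _ ] here-end = record { prefix = [ _ ] ; suffix = [ _ ] ; length-eq = refl ; prefix⊆ = id }
  split (e ∷ P) (here _ _) =
    record { prefix = [ _ ] ; suffix = e ∷ P ; length-eq = refl ; prefix⊆ = λ { here-end → here e P } }
  split (e ∷ P) (there _ z∈) = record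
    { prefix    = e ∷ prefix
    ; suffix    = suffix
    ; length-eq = cong suc length-eq
    ; prefix⊆   = λ { (here _ _) → here e P ; (there _ t∈) → there e (prefix⊆ t∈) }
    }
    where open Split (split P z∈)

  prefix-shortest : {P : Walk G a b k} (s : Split P z) → Shortest G P → Shortest G (Split.prefix s)
  prefix-shortest s sh i′ W = +-cancelʳ-≤ j i i′ (subst (_≤ i′ + j) (sym length-eq) (sh _ (W ++ᵂ suffix)))
    where open Split s

  prefix<length : {P : Walk G a b k} (s : Split P z) → z ≢ b → Split.i s < k
  prefix<length record { suffix = [ _ ] }                         z≢b = ⊥-elim (z≢b refl)
  prefix<length record { i = i ; suffix = _ ∷ _ ; length-eq = refl } _ = m<m+n i (s≤s z≤n)

  onWalk⇒shorter-walk : (P : Walk G a b k) → OnWalk G z P → ∃ λ i → Walk G a z i × i ≤ k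
  onWalk⇒shorter-walk P z∈ with split P z∈
  ... | record { i = i ; j = j ; prefix = pre ; length-eq = refl } = i , pre , m≤m+n i j

  step-along-shortest : (P : Walk G a b k) → Shortest G P → OnWalk G z P → z ≢ b →
                        ∃₂ λ t i → Adj z t × Dist G a z i × Dist G a t (suc i)
  step-along-shortest P sh z∈ z≢b with split P z∈
  ... | record { suffix = [ _ ] } = ⊥-elim (z≢b refl)
  ... | s@record { i = i ; prefix = pre ; suffix = _∷_ {y = t} {k = j} e suf ; length-eq = refl } =
    t , i , e , (pre , prefix-shortest s sh) , (snoc pre e , snoc-shortest)
    where
      snoc-shortest : Shortest G (snoc pre e)
      snoc-shortest i′ W = +-cancelʳ-≤ j (suc i) i′ (subst (_≤ i′ + j) (+-suc i j) (sh _ (W ++ᵂ suf)))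

  WalkWithin : Pred (V G) 0ℓ → V G → V G → ℕ → Set
  WalkWithin p a b k = Σ (Walk G a b k) λ P → ∀ z → OnWalk G z P → p z

  walkWithin? : {p : Pred (V G) 0ℓ} → Decidable p → ∀ k a b → Dec (WalkWithin p a b k)
  walkWithin? {p} p? zero a b with a ≟ b | p? a
  ... | yes refl | yes pa = yes ([ a ] , λ { _ here-end → pa })
  ... | yes refl | no ¬pa = no λ { ([ _ ] , all) → ¬pa (all a here-end) }
  ... | no  a≢b  | _      = no λ { ([ _ ] , _) → a≢b refl }
  walkWithin? {p} p? (suc k) a b with p? a | any? (λ u → adj? a u ×-dec walkWithin? p? k u b)
  ... | no ¬pa | _                    = no λ { (e ∷ Q , all) → ¬pa (all a (here e Q)) }
  ... | yes pa | yes (u , e , Q , all) = yes (e ∷ Q , λ { _ (here _ _) → pa ; z (there _ z∈) → all z z∈ })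
  ... | yes pa | no ¬step             = no λ { (e ∷ Q , all) → ¬step (_ , e , Q , λ z z∈ → all z (there e z∈)) }

  walk? : ∀ k a b → Dec (Walk G a b k)
  walk? k a b = map′ proj₁ (λ W → W , λ _ _ → tt) (walkWithin? (λ _ → yes tt) k a b)

  distance : Connected G → ∀ a b → ∃ (Dist G a b)
  distance connected a b with minimal (λ k → walk? k a b) (proj₂ (connected a b))
  ... | d , P , min = d , P , λ _ W → min W

module Visibility (G : Graph) (connected : Connected G) (x : V G) where
  open Graph G using (n; Adj)
  open Walks G

  private variable
    S : Subset n
    u v w y : V G
    k l : ℕ

  Unobstructed : Subset n → Walk G x y k → Set
  Unobstructed {y = y} S P = ∀ z → OnWalk G z P → z ∈ S → z ≡ x ⊎ z ≡ y

  VisibleAlone : Subset n → V G → Set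
  VisibleAlone S y = ∃ λ k → Σ (Walk G x y k) λ P → Shortest G P × (∀ z → OnWalk G z P → z ∈ S → z ≡ y)

  SVisible? : ∀ S → Decidable (SVisible G x S)
  SVisible? S y with distance connected x y
  ... | d , P₀ , sh₀ = map′ (λ (P , clear) → d , P , sh₀ , clear) to-length-d
                            (walkWithin? (λ z → z ∈? S →-dec (z ≟ x ⊎-dec z ≟ y)) d x y)
    where
      to-length-d : SVisible G x S y → Σ (Walk G x y d) (Unobstructed S)
      to-length-d (k , P , sh , clear) =
        subst (λ k → Σ (Walk G x y k) (Unobstructed S)) (dist-unique (P , sh) (P₀ , sh₀)) (P , clear)

  x-visible : ∀ S → SVisible G x S x
  x-visible S = 0 , [ x ] , (λ _ _ → z≤n) , λ { _ here-end _ → inj₁ refl }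

  member⇒visible : VisibilitySet G x S → y ∈ S → SVisible G x S y
  member⇒visible (_ , witness) y∈S with witness _ y∈S
  ... | k , P , sh , clear = k , P , sh , λ z z∈P z∈S → inj₂ (clear z z∈P z∈S)

  visible-along : (P : Walk G x v k) → Shortest G P → Unobstructed S P → OnWalk G w P → w ≢ v →
                  SVisible G x S w
  visible-along {S = S} {w = w} P sh clear w∈P w≢v =
    i , prefix , prefix-shortest s sh , prefix-clear
    where
      s = split P w∈P
      open Split s
      prefix-clear : Unobstructed S prefix
      prefix-clear z z∈ z∈S with clear z (prefix⊆ z∈) z∈S
      ... | inj₁ z≡x = inj₁ z≡x
      ... | inj₂ refl with onWalk⇒shorter-walk prefix z∈
      ...   | i′ , W , i′≤i = ⊥-elim (<-irrefl refl (≤-<-trans (sh i′ W) (≤-<-trans i′≤i (prefix<length s w≢v))))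

  visible-step : SVisible G x S u → u ∉ S → (e : Adj u w) → Dist G x u k → Dist G x w (suc k) → SVisible G x S w
  visible-step {S = S} (k′ , R , shR , clear) u∉S e Du (_ , shW) =
    suc k′ , snoc R e , shortest , clear′
    where
      shortest : Shortest G (snoc R e)
      shortest k″ W = subst (λ d → suc d ≤ k″) (sym (dist-unique (R , shR) Du)) (shW k″ W)
      clear′ : Unobstructed S (snoc R e)
      clear′ z z∈ z∈S with onWalk-snoc⁻ R e z∈
      ... | inj₂ z≡w = inj₂ z≡w
      ... | inj₁ z∈R with clear z z∈R z∈S
      ...   | inj₁ z≡x = inj₁ z≡x
      ...   | inj₂ refl = ⊥-elim (u∉S z∈S)

  hidden-entry : Dist G x w k → ¬ SVisible G x S w →
                 ∃₂ λ w′ u → ¬ SVisible G x S w′ × u ∈ S × Adj u w′ ×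
                   ∃ λ k′ → Dist G x u k′ × Dist G x w′ (suc k′)
  -- Shortest depends only on the length of a walk, so sh : Shortest P also bounds the walk snoc Q e.
  hidden-entry {k = zero}  (P , _) hidden = ⊥-elim (hidden (subst (SVisible G x _) (walk₀⇒≡ P) (x-visible _)))
  hidden-entry {w = w} {k = suc k} {S = S} (P , sh) hidden with unsnoc P
  ... | u , Q , e with u ∈? S | SVisible? S u
  ...   | yes u∈S | _          = w , u , hidden , u∈S , e , k , Du , (P , sh)
    where Du = Q , shortest-init Q e sh
  ...   | no  u∉S | yes u-vis  = ⊥-elim (hidden (visible-step u-vis u∉S e (Q , shortest-init Q e sh) (P , sh)))
  ...   | no  u∉S | no  hidden′ = hidden-entry (Q , shortest-init Q e sh) hidden′

  hidden-on-unobstructed⇒end : ¬ SVisible G x S w → (P : Walk G x v l) → Shortest G P → Unobstructed S P →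
                               OnWalk G w P → w ≡ v
  hidden-on-unobstructed⇒end {w = w} {v = v} hidden P sh clear w∈P with w ≟ v
  ... | yes w≡v = w≡v
  ... | no  w≢v = ⊥-elim (hidden (visible-along P sh clear w∈P w≢v))

  visibleSet : Subset n → Subset n
  visibleSet S = tabulate (does ∘ SVisible? S)

  visible⇒∈visibleSet : SVisible G x S y → y ∈ visibleSet S
  visible⇒∈visibleSet {S = S} {y = y} vis =
    lookup⇒[]= y _ (trans (lookup∘tabulate _ y) (dec-true (SVisible? S y) vis))

  ∈visibleSet⇒visible : y ∈ visibleSet S → SVisible G x S y
  ∈visibleSet⇒visible {y = y} {S = S} y∈ =
    decidable-stable (SVisible? S y) λ hidden →
      case trans (sym ([]=⇒lookup y∈)) (trans (lookup∘tabulate _ y) (dec-false (SVisible? S y) hidden)) of λ ()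

  module Swap (VS : VisibilitySet G x S) (hidden : ¬ SVisible G x S w) (u∈S : u ∈ S) (e : Adj u w)
              (Du : Dist G x u k) (Dw : Dist G x w (suc k)) where

    S′ : Subset n
    S′ = (S [ u ]≔ outside) [ w ]≔ inside

    w∉S : w ∉ S
    w∉S w∈S = hidden (member⇒visible VS w∈S)

    u≢w : u ≢ w
    u≢w refl = w∉S u∈S

    ∣S′∣≡∣S∣ : ∣ S′ ∣ ≡ ∣ S ∣
    ∣S′∣≡∣S∣ = trans (i∉p⇒∣p[i]≔inside∣≡1+∣p∣ _ w (w∉S ∘ j∈p[i]≔outside⇒j∈p S))
                     (sym (i∈p⇒∣p∣≡1+∣p[i]≔outside∣ S u u∈S))

    u∉S′ : u ∉ S′
    u∉S′ = i∉p[i]≔outside S u ∘ j∈p[i]≔b⇒j∈p _ inside u≢w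

    S′⊆S : ∀ {z} → z ∈ S′ → z ≢ w → z ∈ S
    S′⊆S z∈S′ z≢w = j∈p[i]≔outside⇒j∈p S (j∈p[i]≔b⇒j∈p _ inside z≢w z∈S′)

    witness′ : ∀ y → y ∈ S′ → VisibleAlone S′ y
    witness′ y y∈S′ with y ≟ w | proj₂ VS u u∈S
    ... | yes refl | k′ , R , shR , clear = suc k′ , snoc R e , shortest , clear′
      where
        shortest : Shortest G (snoc R e)
        shortest k″ W = subst (λ d → suc d ≤ k″) (sym (dist-unique (R , shR) Du)) (proj₂ Dw k″ W)
        clear′ : ∀ z → OnWalk G z (snoc R e) → z ∈ S′ → z ≡ w
        clear′ z z∈ z∈S′ with z ≟ w | onWalk-snoc⁻ R e z∈
        ... | yes z≡w | _         = z≡w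
        ... | no  z≢w | inj₂ z≡w  = ⊥-elim (z≢w z≡w)
        ... | no  z≢w | inj₁ z∈R  = ⊥-elim (u∉S′ (subst (_∈ S′) (clear z z∈R (S′⊆S z∈S′ z≢w)) z∈S′))
    ... | no y≢w | _ with proj₂ VS y (S′⊆S y∈S′ y≢w)
    ...   | k′ , P , sh , clear = k′ , P , sh , clear′
      where
        clear′ : ∀ z → OnWalk G z P → z ∈ S′ → z ≡ y
        clear′ z z∈P z∈S′ with z ≟ w
        ... | yes refl = hidden-on-unobstructed⇒end hidden P sh (λ t t∈P t∈S → inj₂ (clear t t∈P t∈S)) z∈P
        ... | no  z≢w  = clear z z∈P (S′⊆S z∈S′ z≢w)

    visibilitySet′ : VisibilitySet G x S′
    visibilitySet′ = x∉S′ , witness′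
      where
        x∉S′ : x ∉ S′
        x∉S′ x∈S′ with x ≟ w
        ... | yes refl = hidden (x-visible S)
        ... | no  x≢w  = proj₁ VS (S′⊆S x∈S′ x≢w)

    visible⇒visible′ : SVisible G x S v → SVisible G x S′ v
    visible⇒visible′ (k′ , P , sh , clear) = k′ , P , sh , clear′
      where
        clear′ : Unobstructed S′ P
        clear′ z z∈P z∈S′ with z ≟ w
        ... | yes refl = inj₂ (hidden-on-unobstructed⇒end hidden P sh clear z∈P)
        ... | no  z≢w  = clear z z∈P (S′⊆S z∈S′ z≢w)

    visibleSet⊂visibleSet′ : ∣ visibleSet S ∣ < ∣ visibleSet S′ ∣
    visibleSet⊂visibleSet′ = p⊂q⇒∣p∣<∣q∣
      ( visible⇒∈visibleSet ∘ visible⇒visible′ ∘ ∈visibleSet⇒visible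
      , w , visible⇒∈visibleSet (member⇒visible visibilitySet′ (i∈p[i]≔inside _ w))
      , hidden ∘ ∈visibleSet⇒visible )

  visibleSet-growth : VisibilitySet G x S → ¬ SVisible G x S w →
                      ∃ λ S′ → VisibilitySet G x S′ × ∣ S′ ∣ ≡ ∣ S ∣ × ∣ visibleSet S ∣ < ∣ visibleSet S′ ∣
  visibleSet-growth {w = w} VS hidden with hidden-entry (proj₂ (distance connected x w)) hidden
  ... | w′ , u , hidden′ , u∈S , e , k , Du , Dw′ = S′ , visibilitySet′ , ∣S′∣≡∣S∣ , visibleSet⊂visibleSet′
    where open Swap VS hidden′ u∈S e Du Dw′

  all-visible : VisibilitySet G x S →
                ∃ λ S′ → VisibilitySet G x S′ × ∣ S′ ∣ ≡ ∣ S ∣ × (∀ y → SVisible G x S′ y)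
  all-visible VS = go (suc n) VS (s≤s (m≤m+n n _))
    where
      go : ∀ fuel {S} → VisibilitySet G x S → n < fuel + ∣ visibleSet S ∣ →
           ∃ λ S′ → VisibilitySet G x S′ × ∣ S′ ∣ ≡ ∣ S ∣ × (∀ y → SVisible G x S′ y)
      go zero {S} _ n< = ⊥-elim (<-irrefl refl (<-≤-trans n< (∣p∣≤n (visibleSet S))))
      go (suc fuel) {S} VS n< with all? (SVisible? S)
      ... | yes visible = S , VS , refl , visible
      ... | no ¬visible with ¬∀⟶∃¬ n _ (SVisible? S) ¬visible
      ...   | w , hidden with visibleSet-growth VS hidden
      ...     | S′ , VS′ , ∣S′∣≡∣S∣ , grows =
        let S″ , VS″ , ∣S″∣≡∣S′∣ , visible = go fuel VS′ (≤-trans n< (+-monoʳ-< fuel grows))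
        in  S″ , VS″ , trans ∣S″∣≡∣S′∣ ∣S′∣≡∣S∣ , visible

module MaximumVisibilitySet (G : Graph) (connected : Connected G) (x : V G) where
  open Graph G using (n; Adj; irrefl)
  open Walks G
  open Visibility G connected x

  private variable
    S : Subset n
    y : V G

  x-not-maxDist : 2 ≤ n → ¬ MaxDist G x x
  x-not-maxDist two md with ∃-other two x
  ... | y , y≢x with connected x y
  ...   | zero  , W     = y≢x (sym (walk₀⇒≡ W))
  ...   | suc _ , e ∷ _ with distance connected x _
  ...     | zero  , P , _ = irrefl (subst (Adj x) (sym (walk₀⇒≡ P)) e)
  ...     | suc d , Dt    = case md _ e 0 (suc d) ([ x ] , λ _ _ → z≤n) Dt of λ ()

  insert-maxDist : VisibilitySet G x S → SVisible G x S y → MaxDist G x y → y ≢ x →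
                   VisibilitySet G x (S [ y ]≔ inside)
  insert-maxDist {S = S} {y = y} VS (k , P , sh , clear) md y≢x = x∉S⁺ , witness⁺
    where
      S⁺ = S [ y ]≔ inside

      x∉S⁺ : x ∉ S⁺
      x∉S⁺ = proj₁ VS ∘ j∈p[i]≔b⇒j∈p S inside (y≢x ∘ sym)

      witness⁺ : ∀ z → z ∈ S⁺ → VisibleAlone S⁺ z
      witness⁺ z z∈S⁺ with z ≟ y
      witness⁺ z z∈S⁺ | yes refl = k , P , sh , clear⁺
        where
          clear⁺ : ∀ t → OnWalk G t P → t ∈ S⁺ → t ≡ z
          clear⁺ t t∈P t∈S⁺ with t ≟ z
          ... | yes t≡z = t≡z
          ... | no  t≢z with j∈p[i]≔b⇒j∈p S inside t≢z t∈S⁺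
          ...   | t∈S with clear t t∈P t∈S
          ...     | inj₁ refl = ⊥-elim (proj₁ VS t∈S)
          ...     | inj₂ t≡z  = t≡z
      witness⁺ z z∈S⁺ | no z≢y with proj₂ VS z (j∈p[i]≔b⇒j∈p S inside z≢y z∈S⁺)
      ... | k′ , Q , shQ , clearQ = k′ , Q , shQ , clear⁺
        where
          clear⁺ : ∀ t → OnWalk G t Q → t ∈ S⁺ → t ≡ z
          clear⁺ t t∈Q t∈S⁺ with t ≟ y
          ... | no  t≢y  = clearQ t t∈Q (j∈p[i]≔b⇒j∈p S inside t≢y t∈S⁺)
          ... | yes refl with step-along-shortest Q shQ t∈Q (z≢y ∘ sym)
          ...   | u , i , e , Dy , Du = ⊥-elim (<-irrefl refl (md u e i (suc i) Dy Du))

  maxDist∈ : 2 ≤ n → VisibilitySet G x S → (∀ y → SVisible G x S y) →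
             (∀ S′ → VisibilitySet G x S′ → ∣ S′ ∣ ≤ ∣ S ∣) → MaxDist G x y → y ∈ S
  maxDist∈ {S = S} {y = y} two VS visible maximum md with y ∈? S
  ... | yes y∈S = y∈S
  ... | no  y∉S = ⊥-elim (<-irrefl refl
        (subst (_≤ ∣ S ∣) (i∉p⇒∣p[i]≔inside∣≡1+∣p∣ S y y∉S) (maximum _ (insert-maxDist VS (visible y) md y≢x))))
    where
      y≢x : y ≢ x
      y≢x refl = x-not-maxDist two md

  stress∉ : VisibilitySet G x S → (∀ {z} → MaxDist G x z → z ∈ S) → Stress G x y → y ∉ S
  stress∉ VS md⊆S (_ , z , md , y≢z , on-every) y∈S with proj₂ VS z (md⊆S md)
  ... | k , P , sh , clear = y≢z (clear _ (on-every k P sh) y∈S)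

lemma3p2 : (G : Graph) → Connected G → 2 ≤ Graph.n G →
    (x : V G) (m : ℕ) → IsVisibilityNumber G x m →
    (∃ λ S → VisibilitySet G x S × ∣ S ∣ ≡ m ×
      (∀ y → y ≢ x → SVisible G x S y) ×
      (∀ y → MaxDist G x y → y ∈ S) ×
      (∀ y → Stress G x y → y ∉ S)) ×
    (∀ (M : Subset (Graph.n G)) → (∀ y → (y ∈ M) ⇔ MaxDist G x y) → ∣ M ∣ ≤ m) ×
    (∀ (T : Subset (Graph.n G)) → (∀ y → (y ∈ T) ⇔ Stress G x y) → m + ∣ T ∣ + 1 ≤ Graph.n G)
lemma3p2 G connected two x m ((S₀ , VS₀ , ∣S₀∣≡m) , maximum)
  with Visibility.all-visible G connected x VS₀
... | S , VS , ∣S∣≡∣S₀∣ , visible =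
  (S , VS , ∣S∣≡m , (λ y _ → visible y) , md⊆S , stress∉S) , md-bound , stress-bound
  where
    open MaximumVisibilitySet G connected x
    ∣S∣≡m : ∣ S ∣ ≡ m
    ∣S∣≡m = trans ∣S∣≡∣S₀∣ ∣S₀∣≡m

    md⊆S : ∀ y → MaxDist G x y → y ∈ S
    md⊆S y = maxDist∈ two VS visible (λ S′ VS′ → subst (∣ S′ ∣ ≤_) (sym ∣S∣≡m) (maximum S′ VS′))

    stress∉S : ∀ y → Stress G x y → y ∉ S
    stress∉S y = stress∉ VS (md⊆S _)

    md-bound : ∀ M → (∀ y → (y ∈ M) ⇔ MaxDist G x y) → ∣ M ∣ ≤ m
    md-bound M M≡MD = subst (∣ M ∣ ≤_) ∣S∣≡m (p⊆q⇒∣p∣≤∣q∣ λ {y} y∈M → md⊆S y (Equivalence.to (M≡MD y) y∈M))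

    stress-bound : ∀ T → (∀ y → (y ∈ T) ⇔ Stress G x y) → m + ∣ T ∣ + 1 ≤ Graph.n G
    stress-bound T T≡str = subst (λ s → s + ∣ T ∣ + 1 ≤ Graph.n G) ∣S∣≡m
      (disjoint-avoiding⇒∣p∣+∣q∣+1≤n S T (λ y y∈S y∈T → stress∉S y (Equivalence.to (T≡str y) y∈T) y∈S)
        (proj₁ VS) (λ x∈T → proj₁ (Equivalence.to (T≡str x) x∈T) refl))
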